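{- Let $V$ be a finite non-empty set and $T:\mathscr{P}(V)\to\mathscr{P}(V)$ a map. Suppose $(E_1,E_2)$ is the unique pair of equivalence relations on $V$ with $T(X)=\mathbf{l}_{E_2}(\mathbf{l}_{E_1}(X))$ for all $X\subseteq V$. Then (i) if every equivalence class of $E_1$ has at least two elements, $\gamma(E_1,E_2)=0$; (ii) if every equivalence class of $E_2$ has at least two elements, $\gamma(E_2,E_1)=0$.
   Context: For an equivalence relation $E$ on $V$: $\mathbf{l}_E(X)=\{x\in V:[x]_E\subseteq X\}$. For equivalence relations $C,D$ on $V$, $POS_C(D)=\bigcup_{X\in V/D}\mathbf{l}_C(X)$ and $\gamma(C,D)=|POS_C(D)|/|V|$. -}

module Defs where

open import Level using (0ℓ)
open import Data.Nat using (ℕ; suc)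
open import Data.Integer using (+_)
open import Data.Rational using (ℚ; _/_)
open import Data.Fin using (Fin)
open import Data.Fin.Properties using (all?)
open import Data.Fin.Subset using (Subset; _∈_; ⋃; ∣_∣)
open import Data.Fin.Subset.Properties using (_∈?_)
open import Data.Vec using (tabulate)
open import Data.List using (map)
open import Relation.Binary using (Rel; IsEquivalence; Decidable)
open import Relation.Nullary using (Dec)
open import Relation.Nullary.Decidable using (⌊_⌋; _→-dec_)
open import Data.List using (List)
import Data.List.Base

record EqRel (n : ℕ) : Set₁ where
  field
    _∼_           : Rel (Fin n) 0ℓ
    isEquivalence : IsEquivalence _∼_
    dec           : Decidable _∼_
open EqRel public

allFinL : (n : ℕ) → List (Fin n)
allFinL n = Data.List.Base.allFin n

eqClass : ∀ {n} → EqRel n → Fin n → Subset n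
eqClass E x = tabulate (λ y → ⌊ dec E x y ⌋)

lower : ∀ {n} → EqRel n → Subset n → Subset n
lower E X = tabulate (λ x → ⌊ all? (λ y → dec E x y →-dec (y ∈? X)) ⌋)

-- POS_C(D) = ⋃_{X ∈ V/D} l_C(X); the blocks of V/D are the classes [z]_D
POS : ∀ {n} → EqRel n → EqRel n → Subset n
POS {n} C D = ⋃ (map (λ z → lower C (eqClass D z)) (allFinL n))

γ : ∀ {m} → EqRel (suc m) → EqRel (suc m) → ℚ
γ {m} C D = (+ ∣ POS C D ∣) / suc m

-- If x ∈ POS_C(D) then [x]_C lies inside a single D-class.  Shattering [x]_C into
-- singletons then leaves the composite l_{E₂} ∘ l_{E₁} unchanged (with C = E₁, D = E₂
-- for (i), and C = E₂, D = E₁ for (ii)), so by uniqueness the shattered relation is the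
-- original one and [x]_C = {x}, contradicting the assumption that classes have at least
-- two elements.  Hence POS_C(D) is empty and γ(C,D) = 0.
module Submission where

open import Defs
open import Data.Nat using (ℕ; suc; _≤_)
open import Data.Fin using (Fin)
open import Data.Fin.Subset using (Subset; ∣_∣)
open import Data.Rational using (0ℚ)
open import Data.Product using (_×_)
open import Function.Bundles using (_⇔_)
open import Relation.Binary.PropositionalEquality using (_≡_)

open import Data.Bool using (Bool; true)
open import Data.Bool.Properties using (T-≡)
open import Data.Fin using (_≟_)
open import Data.Fin.Subset using (_∈_; _∉_; _⊆_; ⁅_⁆; ⋃) renaming (⊥ to ∅)
open import Data.Fin.Subset.Properties
  using (⊆-antisym; ∉⊥; Empty-unique; ∣⊥∣≡0; x∈⁅x⁆; x∈⁅y⁆⇒x≡y; ∣⁅x⁆∣≡1; x∈p∪q⁻)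
open import Data.Integer using (+_)
open import Data.List using (List; []; _∷_; map)
open import Data.List.Relation.Unary.Any using (Any; here; there; satisfied)
import Data.List.Relation.Unary.Any.Properties as Any
open import Data.Nat.Properties using (<-irrefl)
open import Data.Product using (_,_; ∃-syntax; proj₁; proj₂)
open import Data.Rational using (_/_)
open import Data.Rational.Properties using (0/n≡0)
open import Data.Sum using (_⊎_; inj₁; inj₂)
open import Data.Vec using (tabulate)
open import Data.Vec.Properties using ([]=⇒lookup; lookup⇒[]=; lookup∘tabulate)
open import Function.Bundles using (mk⇔; Equivalence)
open import Level using (0ℓ)
open import Relation.Binary using (Rel; IsEquivalence; Symmetric; Transitive)
open import Relation.Binary.PropositionalEquality using (refl; sym; trans; cong; subst; module ≡-Reasoning)
open import Relation.Nullary using (Dec; yes; no; ¬_; contradiction)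
open import Relation.Nullary.Decidable using (⌊_⌋; _⊎-dec_; _×-dec_; ¬?; toWitness; fromWitness)

private
  variable
    n : ℕ

infix 4 _⊢_∼_

_⊢_∼_ : EqRel n → Fin n → Fin n → Set
E ⊢ x ∼ y = _∼_ E x y

module _ (E : EqRel n) where
  private module E = IsEquivalence (isEquivalence E)

  ∼-refl : ∀ {x} → E ⊢ x ∼ x
  ∼-refl = E.refl

  ∼-sym : ∀ {x y} → E ⊢ x ∼ y → E ⊢ y ∼ x
  ∼-sym = E.sym

  ∼-trans : ∀ {x y z} → E ⊢ x ∼ y → E ⊢ y ∼ z → E ⊢ x ∼ z
  ∼-trans = E.trans

∈-tabulate⇔ : (f : Fin n → Bool) {x : Fin n} → x ∈ tabulate f ⇔ f x ≡ true
∈-tabulate⇔ f {x} = mk⇔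
  (λ x∈ → trans (sym (lookup∘tabulate f x)) ([]=⇒lookup x∈))
  (λ fx → lookup⇒[]= x (tabulate f) (trans (lookup∘tabulate f x) fx))

∈-tabulate-dec⇔ : {P : Fin n → Set} (P? : ∀ x → Dec (P x)) {x : Fin n} →
  x ∈ tabulate (λ y → ⌊ P? y ⌋) ⇔ P x
∈-tabulate-dec⇔ P? {x} = mk⇔
  (λ x∈ → toWitness (Equivalence.from T-≡ (Equivalence.to (∈-tabulate⇔ _) x∈)))
  (λ p → Equivalence.from (∈-tabulate⇔ _) (Equivalence.to T-≡ (fromWitness p)))

∈-eqClass⇔ : (E : EqRel n) {x y : Fin n} → y ∈ eqClass E x ⇔ E ⊢ x ∼ y
∈-eqClass⇔ E {x} = ∈-tabulate-dec⇔ (dec E x)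

∈-lower⇔ : (E : EqRel n) (X : Subset n) {x : Fin n} →
  x ∈ lower E X ⇔ (∀ y → E ⊢ x ∼ y → y ∈ X)
∈-lower⇔ E X = ∈-tabulate-dec⇔ _

∈-lower⁻ : (E : EqRel n) (X : Subset n) {x : Fin n} →
  x ∈ lower E X → ∀ {y} → E ⊢ x ∼ y → y ∈ X
∈-lower⁻ E X x∈ {y} = Equivalence.to (∈-lower⇔ E X) x∈ y

∈-lower⁺ : (E : EqRel n) (X : Subset n) {x : Fin n} →
  (∀ {y} → E ⊢ x ∼ y → y ∈ X) → x ∈ lower E X
∈-lower⁺ E X h = Equivalence.from (∈-lower⇔ E X) (λ _ → h)

∈-lower-resp-∼ : (E : EqRel n) (X : Subset n) {x y : Fin n} →
  x ∈ lower E X → E ⊢ x ∼ y → y ∈ lower E X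
∈-lower-resp-∼ E X x∈ xy = ∈-lower⁺ E X (λ yu → ∈-lower⁻ E X x∈ (∼-trans E xy yu))

lower-antitone : (E F : EqRel n) → (∀ {x y} → F ⊢ x ∼ y → E ⊢ x ∼ y) →
  ∀ X → lower E X ⊆ lower F X
lower-antitone E F F⊆E X x∈ = ∈-lower⁺ F X (λ r → ∈-lower⁻ E X x∈ (F⊆E r))

lower-monotone : (E : EqRel n) {X Y : Subset n} → X ⊆ Y → lower E X ⊆ lower E Y
lower-monotone E {X} {Y} X⊆Y x∈ = ∈-lower⁺ E Y (λ r → X⊆Y (∈-lower⁻ E X x∈ r))

shatter : EqRel n → Fin n → EqRel n
shatter E x = record
  { _∼_           = _≈_
  ; isEquivalence = record { refl = inj₁ refl ; sym = symmetric ; trans = transitive }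
  ; dec           = λ a b → (a ≟ b) ⊎-dec (dec E a b ×-dec ¬? (dec E x a))
  }
  where
  _≈_ : Rel (Fin _) 0ℓ
  a ≈ b = a ≡ b ⊎ (E ⊢ a ∼ b × ¬ E ⊢ x ∼ a)

  symmetric : Symmetric _≈_
  symmetric (inj₁ a≡b)       = inj₁ (sym a≡b)
  symmetric (inj₂ (ab , xa)) = inj₂ (∼-sym E ab , λ xb → xa (∼-trans E xb (∼-sym E ab)))

  transitive : Transitive _≈_
  transitive (inj₁ refl)       bc              = bc
  transitive ab                (inj₁ refl)     = ab
  transitive (inj₂ (ab , xa)) (inj₂ (bc , _)) = inj₂ (∼-trans E ab bc , xa)

shatter-⊆ : (E : EqRel n) (x : Fin n) {a b : Fin n} → shatter E x ⊢ a ∼ b → E ⊢ a ∼ b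
shatter-⊆ E x (inj₁ refl)     = ∼-refl E
shatter-⊆ E x (inj₂ (ab , _)) = ab

shatter-class : (E : EqRel n) (x : Fin n) {y : Fin n} → shatter E x ⊢ x ∼ y → y ≡ x
shatter-class E x (inj₁ x≡y)     = sym x≡y
shatter-class E x (inj₂ (_ , xx)) = contradiction (∼-refl E) xx

-- Points of [x]_{E₁} are pairwise E₂-related, so a w ∈ l_{E₂}(l_{F₁} X) that reaches one
-- of them reaches them all, and each one lies in l_{F₁} X, hence in X.
lower∘lower-shatterˡ : (E₁ E₂ : EqRel n) {x z : Fin n} →
  (∀ {v} → E₁ ⊢ x ∼ v → E₂ ⊢ z ∼ v) →
  ∀ X → lower E₂ (lower E₁ X) ≡ lower E₂ (lower (shatter E₁ x) X)
lower∘lower-shatterˡ E₁ E₂ {x} [x]⊆[z] X = ⊆-antisym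
  (lower-monotone E₂ (lower-antitone E₁ F₁ (shatter-⊆ E₁ x) X))
  (λ {w} w∈ → ∈-lower⁺ E₂ (lower E₁ X) (λ {y} wy → ∈-lower⁺ E₁ X (λ yu →
     shattered-points w∈ wy yu (dec E₁ x y))))
  where
  F₁ = shatter E₁ x

  shattered-points : ∀ {w y u} → w ∈ lower E₂ (lower F₁ X) → E₂ ⊢ w ∼ y → E₁ ⊢ y ∼ u →
    Dec (E₁ ⊢ x ∼ y) → u ∈ X
  shattered-points {u = u} w∈ wy yu (yes xy) =
    ∈-lower⁻ F₁ X (∈-lower⁻ E₂ (lower F₁ X) w∈ wu) (inj₁ refl)
    where
    wu : E₂ ⊢ _ ∼ u
    wu = ∼-trans E₂ wy (∼-trans E₂ (∼-sym E₂ ([x]⊆[z] xy)) ([x]⊆[z] (∼-trans E₁ xy yu)))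
  shattered-points w∈ wy yu (no ¬xy) =
    ∈-lower⁻ F₁ X (∈-lower⁻ E₂ (lower F₁ X) w∈ wy) (inj₂ (yu , ¬xy))

-- Points of [x]_{E₂} are pairwise E₁-related and l_{E₁} X is E₁-closed, so it contains
-- all of [x]_{E₂} as soon as it contains one of its points.
lower∘lower-shatterʳ : (E₁ E₂ : EqRel n) {x z : Fin n} →
  (∀ {v} → E₂ ⊢ x ∼ v → E₁ ⊢ z ∼ v) →
  ∀ X → lower E₂ (lower E₁ X) ≡ lower (shatter E₂ x) (lower E₁ X)
lower∘lower-shatterʳ E₁ E₂ {x} [x]⊆[z] X = ⊆-antisym
  (lower-antitone E₂ F₂ (shatter-⊆ E₂ x) L)
  (λ {w} w∈ → ∈-lower⁺ E₂ L (λ wy → shattered-points w∈ wy (dec E₂ x w)))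
  where
  F₂ = shatter E₂ x
  L  = lower E₁ X

  shattered-points : ∀ {w y} → w ∈ lower F₂ L → E₂ ⊢ w ∼ y → Dec (E₂ ⊢ x ∼ w) → y ∈ L
  shattered-points {w} {y} w∈ wy (yes xw) =
    ∈-lower-resp-∼ E₁ X (∈-lower⁻ F₂ L w∈ (inj₁ refl)) w∼₁y
    where
    w∼₁y : E₁ ⊢ w ∼ y
    w∼₁y = ∼-trans E₁ (∼-sym E₁ ([x]⊆[z] xw)) ([x]⊆[z] (∼-trans E₂ xw wy))
  shattered-points w∈ wy (no ¬xw) = ∈-lower⁻ F₂ L w∈ (inj₂ (wy , ¬xw))

∈-⋃⁻ : {ps : List (Subset n)} {x : Fin n} → x ∈ ⋃ ps → Any (x ∈_) ps
∈-⋃⁻ {ps = []}     x∈ = contradiction x∈ ∉⊥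
∈-⋃⁻ {ps = p ∷ ps} x∈ with x∈p∪q⁻ p (⋃ ps) x∈
... | inj₁ x∈p  = here x∈p
... | inj₂ x∈ps = there (∈-⋃⁻ x∈ps)

∈-POS⁻ : (C D : EqRel n) {x : Fin n} → x ∈ POS C D →
  ∃[ z ] (∀ {v} → C ⊢ x ∼ v → D ⊢ z ∼ v)
∈-POS⁻ {n} C D x∈ with satisfied (Any.map⁻ (∈-⋃⁻ {ps = map _ (allFinL n)} x∈))
... | z , x∈l = z , λ xv → Equivalence.to (∈-eqClass⇔ D) (∈-lower⁻ C _ x∈l xv)

eqClass≡⁅⁆ : (E : EqRel n) {x : Fin n} → (∀ {y} → E ⊢ x ∼ y → y ≡ x) → eqClass E x ≡ ⁅ x ⁆
eqClass≡⁅⁆ E {x} singleton = ⊆-antisym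
  (λ y∈ → subst (_∈ ⁅ x ⁆) (sym (singleton (Equivalence.to (∈-eqClass⇔ E) y∈))) (x∈⁅x⁆ x))
  (λ y∈ → Equivalence.from (∈-eqClass⇔ E) (subst (E ⊢ x ∼_) (sym (x∈⁅y⁆⇒x≡y x y∈)) (∼-refl E)))

2≤∣eqClass∣⇒¬singleton : (E : EqRel n) {x : Fin n} → 2 ≤ ∣ eqClass E x ∣ →
  ¬ (∀ {y} → E ⊢ x ∼ y → y ≡ x)
2≤∣eqClass∣⇒¬singleton E {x} 2≤ singleton =
  <-irrefl refl (subst (2 ≤_) (trans (cong ∣_∣ (eqClass≡⁅⁆ E singleton)) (∣⁅x⁆∣≡1 x)) 2≤)

γ≡0 : ∀ {m} (C D : EqRel (suc m)) → (∀ x → x ∉ POS C D) → γ C D ≡ 0ℚ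
γ≡0 {m} C D ∉POS = begin
  (+ ∣ POS C D ∣) / suc m   ≡⟨ cong (λ p → (+ ∣ p ∣) / suc m) (Empty-unique (λ (x , x∈) → ∉POS x x∈)) ⟩
  (+ ∣ ∅ {suc m} ∣) / suc m ≡⟨ cong (λ k → (+ k) / suc m) (∣⊥∣≡0 (suc m)) ⟩
  (+ 0) / suc m             ≡⟨ 0/n≡0 (suc m) ⟩
  0ℚ                        ∎
  where open ≡-Reasoning

mainTheorem9 : (m : ℕ) (T : Subset (suc m) → Subset (suc m))
    (E₁ E₂ : EqRel (suc m)) →
    (∀ X → T X ≡ lower E₂ (lower E₁ X)) →
    (∀ (F₁ F₂ : EqRel (suc m)) → (∀ X → T X ≡ lower F₂ (lower F₁ X)) →
      (∀ x y → _∼_ F₁ x y ⇔ _∼_ E₁ x y) × (∀ x y → _∼_ F₂ x y ⇔ _∼_ E₂ x y)) →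
    ((∀ x → 2 ≤ ∣ eqClass E₁ x ∣) → γ E₁ E₂ ≡ 0ℚ)
    × ((∀ x → 2 ≤ ∣ eqClass E₂ x ∣) → γ E₂ E₁ ≡ 0ℚ)
mainTheorem9 _ _ E₁ E₂ T≡ unique = part₁ , part₂
  where
  part₁ : (∀ x → 2 ≤ ∣ eqClass E₁ x ∣) → γ E₁ E₂ ≡ 0ℚ
  part₁ big = γ≡0 E₁ E₂ λ x x∈POS →
    let z , [x]⊆[z] = ∈-POS⁻ E₁ E₂ x∈POS
        T≡shattered = λ X → trans (T≡ X) (lower∘lower-shatterˡ E₁ E₂ [x]⊆[z] X)
        F₁⇔E₁ = proj₁ (unique (shatter E₁ x) E₂ T≡shattered) x
    in 2≤∣eqClass∣⇒¬singleton E₁ (big x)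
         (λ xy → shatter-class E₁ x (Equivalence.from (F₁⇔E₁ _) xy))

  part₂ : (∀ x → 2 ≤ ∣ eqClass E₂ x ∣) → γ E₂ E₁ ≡ 0ℚ
  part₂ big = γ≡0 E₂ E₁ λ x x∈POS →
    let z , [x]⊆[z] = ∈-POS⁻ E₂ E₁ x∈POS
        T≡shattered = λ X → trans (T≡ X) (lower∘lower-shatterʳ E₁ E₂ [x]⊆[z] X)
        F₂⇔E₂ = proj₂ (unique E₁ (shatter E₂ x) T≡shattered) x
    in 2≤∣eqClass∣⇒¬singleton E₂ (big x)
         (λ xy → shatter-class E₂ x (Equivalence.from (F₂⇔E₂ _) xy))
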